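{- Let $G$ be a graph. If $\ell_1$ and $\ell_2$ are leaves of $G$ with support vertices $y_1$ and $y_2$, respectively, and $N(y_1)=\{\ell_1,x\}$ and $N(y_2)=\{\ell_2,x\}$, then $G$ does not have a unique maximum open packing.
   Context: An open packing in a graph is a set of vertices whose open neighborhoods are pairwise disjoint. A leaf is a vertex of degree 1 and its neighbor is its support vertex. $N(v)$ denotes the open neighborhood of $v$. -}

module Defs where

open import Data.Nat using (ℕ; _≤_)
open import Data.Fin using (Fin)
open import Data.Fin.Subset using (Subset; _∈_; ∣_∣)
open import Data.Bool using (Bool; true; false)
open import Data.Product using (Σ; _×_; ∃)
open import Data.Sum using (_⊎_)
open import Relation.Binary.PropositionalEquality using (_≡_; _≢_)
open import Relation.Nullary using (¬_)

record Graph (n : ℕ) : Set where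
  field
    edge  : Fin n → Fin n → Bool
    sym   : ∀ u v → edge u v ≡ edge v u
    irrefl : ∀ v → edge v v ≡ false

module _ {n : ℕ} (G : Graph n) where
  open Graph G

  Adj : Fin n → Fin n → Set
  Adj u v = edge u v ≡ true

  IsLeafWithSupport : Fin n → Fin n → Set
  IsLeafWithSupport ℓ y = ∀ w → (Adj ℓ w → w ≡ y) × (w ≡ y → Adj ℓ w)

  NbhdIsPair : Fin n → Fin n → Fin n → Set
  NbhdIsPair y a b = ∀ w → (Adj y w → w ≡ a ⊎ w ≡ b) × (w ≡ a ⊎ w ≡ b → Adj y w)

  IsOpenPacking : Subset n → Set
  IsOpenPacking S = ∀ u v → u ∈ S → v ∈ S → u ≢ v → ∀ w → ¬ (Adj u w × Adj v w)

  IsMaximumOpenPacking : Subset n → Set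
  IsMaximumOpenPacking S = IsOpenPacking S × (∀ T → IsOpenPacking T → ∣ T ∣ ≤ ∣ S ∣)

  HasUniqueMaxOpenPacking : Set
  HasUniqueMaxOpenPacking =
    Σ (Subset n) λ S → IsMaximumOpenPacking S × (∀ T → IsMaximumOpenPacking T → T ≡ S)

module Submission where

-- Key observation: a support y with N(y) = {ℓ, x} can be added to any open
-- packing none of whose members is adjacent to x, since the only other
-- vertex of N(y), the leaf ℓ, has no neighbour besides y.  Now let S be a
-- maximum open packing.  If no member of S were adjacent to x, S ∪ {y₁}
-- would be a larger open packing; so some z ∈ S is adjacent to x, and by
-- the packing property it is the only one.  The supports y₁ ≠ y₂ cannot both
-- equal z; for the one that differs, (S ∖ {z}) ∪ {y} is an open packing of
-- the same size that misses z, i.e. a second maximum open packing.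

open import Defs
open import Data.Nat using (ℕ; suc; _≤_)
open import Data.Nat.Properties using (≤-trans; ≤-reflexive; n≮n)
open import Data.Fin using (Fin; zero; suc)
open import Data.Fin.Properties using (any?; suc-injective; _≟_)
open import Data.Fin.Subset using (Subset; inside; outside; _∈_; _∉_; _⊆_; ∣_∣)
open import Data.Fin.Subset.Properties using (_∈?_)
open import Data.Bool using (true)
open import Data.Bool.Properties using () renaming (_≟_ to _≟ᵇ_)
open import Data.Vec using (_∷_; _[_]≔_; here; there)
open import Data.Product using (∃; _×_; _,_; proj₁; proj₂)
open import Data.Sum using (_⊎_; inj₁; inj₂)
import Data.Sum as Sum
open import Data.Empty using (⊥-elim)
open import Function using (_∘_)
open import Relation.Binary.PropositionalEquality
  using (_≡_; _≢_; refl; sym; trans; cong; subst; module ≡-Reasoning)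
open import Relation.Nullary using (¬_; Dec; yes; no)
open import Relation.Nullary.Decidable using (_×-dec_; decidable-stable)

∈-insert⁻ : ∀ {n} {p : Subset n} {y u : Fin n} →
  u ∈ (p [ y ]≔ inside) → u ≡ y ⊎ u ∈ p
∈-insert⁻ {p = _ ∷ _} {zero}  here        = inj₁ refl
∈-insert⁻ {p = _ ∷ _} {zero}  (there u∈p) = inj₂ (there u∈p)
∈-insert⁻ {p = _ ∷ _} {suc y} here        = inj₂ here
∈-insert⁻ {p = _ ∷ _} {suc y} (there u∈p) = Sum.map (cong suc) there (∈-insert⁻ u∈p)

∈-remove⁻ : ∀ {n} {p : Subset n} {z u : Fin n} →
  u ∈ (p [ z ]≔ outside) → u ∈ p × u ≢ z
∈-remove⁻ {p = _ ∷ _} {zero}  (there u∈p) = there u∈p , λ ()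
∈-remove⁻ {p = _ ∷ _} {suc z} here        = here , λ ()
∈-remove⁻ {p = _ ∷ _} {suc z} (there u∈p) with ∈-remove⁻ u∈p
... | u∈p′ , u≢z = there u∈p′ , u≢z ∘ suc-injective

∣insert∣ : ∀ {n} (p : Subset n) (y : Fin n) → y ∉ p → ∣ p [ y ]≔ inside ∣ ≡ suc ∣ p ∣
∣insert∣ (inside  ∷ p) zero    y∉p = ⊥-elim (y∉p here)
∣insert∣ (outside ∷ p) zero    y∉p = refl
∣insert∣ (inside  ∷ p) (suc y) y∉p = cong suc (∣insert∣ p y (y∉p ∘ there))
∣insert∣ (outside ∷ p) (suc y) y∉p = ∣insert∣ p y (y∉p ∘ there)

∣remove∣ : ∀ {n} {p : Subset n} {z : Fin n} → z ∈ p → suc ∣ p [ z ]≔ outside ∣ ≡ ∣ p ∣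
∣remove∣ here = refl
∣remove∣ {p = inside  ∷ p} (there z∈p) = cong suc (∣remove∣ z∈p)
∣remove∣ {p = outside ∷ p} (there z∈p) = ∣remove∣ z∈p

module _ {n : ℕ} (G : Graph n) where

  adj-sym : ∀ {u v} → Adj G u v → Adj G v u
  adj-sym {u} {v} = trans (Graph.sym G v u)

  adj? : ∀ u v → Dec (Adj G u v)
  adj? u v = Graph.edge G u v ≟ᵇ true

  packing-⊆ : ∀ {S T} → T ⊆ S → IsOpenPacking G S → IsOpenPacking G T
  packing-⊆ T⊆S P u v u∈T v∈T = P u v (T⊆S u∈T) (T⊆S v∈T)

  packing-common-neighbour : ∀ {S u v w} → IsOpenPacking G S →
    u ∈ S → v ∈ S → Adj G u w → Adj G v w → u ≡ v
  packing-common-neighbour {w = w} P u∈S v∈S u~w v~w =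
    decidable-stable (_ ≟ _) (λ u≢v → P _ _ u∈S v∈S u≢v w (u~w , v~w))

  packing-insert : ∀ {S} y → IsOpenPacking G S →
    (∀ v → v ∈ S → v ≢ y → ∀ w → Adj G y w → ¬ Adj G v w) →
    IsOpenPacking G (S [ y ]≔ inside)
  packing-insert y P separated u v u∈T v∈T u≢v w (u~w , v~w)
    with ∈-insert⁻ u∈T | ∈-insert⁻ v∈T
  ... | inj₁ refl | inj₁ refl = u≢v refl
  ... | inj₁ refl | inj₂ v∈S  = separated v v∈S (u≢v ∘ sym) w u~w v~w
  ... | inj₂ u∈S  | inj₁ refl = separated u u∈S u≢v w v~w u~w
  ... | inj₂ u∈S  | inj₂ v∈S  = P u v u∈S v∈S u≢v w (u~w , v~w)

  maximum-of-same-size : ∀ {S T} → IsMaximumOpenPacking G S →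
    IsOpenPacking G T → ∣ T ∣ ≡ ∣ S ∣ → IsMaximumOpenPacking G T
  maximum-of-same-size (_ , maxS) P-T ∣T∣≡∣S∣ =
    P-T , λ U P-U → ≤-trans (maxS U P-U) (≤-reflexive (sym ∣T∣≡∣S∣))

  supports-distinct : ∀ {ℓ₁ ℓ₂ y₁ y₂ x} → ℓ₁ ≢ ℓ₂ →
    NbhdIsPair G y₁ ℓ₁ x → NbhdIsPair G y₂ ℓ₂ x → y₁ ≢ y₂
  supports-distinct {ℓ₁} {ℓ₂} ℓ₁≢ℓ₂ nbhd₁ nbhd₂ refl
    with proj₁ (nbhd₁ ℓ₂) (proj₂ (nbhd₂ ℓ₂) (inj₁ refl))
       | proj₁ (nbhd₂ ℓ₁) (proj₂ (nbhd₁ ℓ₁) (inj₁ refl))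
  ... | inj₁ ℓ₂≡ℓ₁ | _          = ℓ₁≢ℓ₂ (sym ℓ₂≡ℓ₁)
  ... | inj₂ _     | inj₁ ℓ₁≡ℓ₂ = ℓ₁≢ℓ₂ ℓ₁≡ℓ₂
  ... | inj₂ ℓ₂≡x  | inj₂ ℓ₁≡x  = ℓ₁≢ℓ₂ (trans ℓ₁≡x (sym ℓ₂≡x))

  module SupportOf {ℓ y x : Fin n}
    (leaf : IsLeafWithSupport G ℓ y) (nbhd : NbhdIsPair G y ℓ x) where

    y~x : Adj G y x
    y~x = proj₂ (nbhd x) (inj₂ refl)

    support-insert : ∀ {S} → IsOpenPacking G S → (∀ v → v ∈ S → ¬ Adj G v x) →
      IsOpenPacking G (S [ y ]≔ inside)
    support-insert {S} P avoid = packing-insert y P separated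
      where
      separated : ∀ v → v ∈ S → v ≢ y → ∀ w → Adj G y w → ¬ Adj G v w
      separated v v∈S v≢y w y~w v~w with proj₁ (nbhd w) y~w
      ... | inj₁ refl = v≢y (proj₁ (leaf v) (adj-sym v~w))
      ... | inj₂ refl = avoid v v∈S v~w

    maximum-meets-x : ∀ {S} → IsMaximumOpenPacking G S → ∃ λ z → z ∈ S × Adj G z x
    maximum-meets-x {S} (P , maxS) with any? (λ z → (z ∈? S) ×-dec adj? z x)
    ... | yes found = found
    ... | no none = ⊥-elim (n≮n ∣ S ∣ larger)
      where
      avoid : ∀ v → v ∈ S → ¬ Adj G v x
      avoid v v∈S v~x = none (v , v∈S , v~x)
      larger : suc ∣ S ∣ ≤ ∣ S ∣
      larger = subst (_≤ ∣ S ∣) (∣insert∣ S y (λ y∈S → avoid y y∈S y~x))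
                     (maxS _ (support-insert P avoid))

    exchange : ∀ {S z} → IsMaximumOpenPacking G S → z ∈ S → Adj G z x → z ≢ y →
      ∃ λ T → IsMaximumOpenPacking G T × T ≢ S
    exchange {S} {z} maxS z∈S z~x z≢y =
      T , maximum-of-same-size maxS P-T ∣T∣≡∣S∣ , T≢S
      where
      S⁻ T : Subset n
      S⁻ = S [ z ]≔ outside
      T  = S⁻ [ y ]≔ inside

      -- z was the only member of S adjacent to x.
      avoid : ∀ v → v ∈ S⁻ → ¬ Adj G v x
      avoid v v∈S⁻ v~x with ∈-remove⁻ v∈S⁻
      ... | v∈S , v≢z = v≢z (packing-common-neighbour (proj₁ maxS) v∈S z∈S v~x z~x)

      P-T : IsOpenPacking G T
      P-T = support-insert (packing-⊆ (λ v∈S⁻ → proj₁ (∈-remove⁻ v∈S⁻)) (proj₁ maxS)) avoid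

      ∣T∣≡∣S∣ : ∣ T ∣ ≡ ∣ S ∣
      ∣T∣≡∣S∣ = begin
        ∣ T ∣       ≡⟨ ∣insert∣ S⁻ y (λ y∈S⁻ → avoid y y∈S⁻ y~x) ⟩
        suc ∣ S⁻ ∣  ≡⟨ ∣remove∣ z∈S ⟩
        ∣ S ∣       ∎
        where open ≡-Reasoning

      z∉T : z ∉ T
      z∉T z∈T with ∈-insert⁻ z∈T
      ... | inj₁ z≡y  = z≢y z≡y
      ... | inj₂ z∈S⁻ = proj₂ (∈-remove⁻ z∈S⁻) refl

      T≢S : T ≢ S
      T≢S T≡S = z∉T (subst (z ∈_) (sym T≡S) z∈S)

  rival-maximum : ∀ {ℓ₁ ℓ₂ y₁ y₂ x S} → ℓ₁ ≢ ℓ₂ →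
    IsLeafWithSupport G ℓ₁ y₁ → IsLeafWithSupport G ℓ₂ y₂ →
    NbhdIsPair G y₁ ℓ₁ x → NbhdIsPair G y₂ ℓ₂ x →
    IsMaximumOpenPacking G S → ∃ λ T → IsMaximumOpenPacking G T × T ≢ S
  rival-maximum {y₁ = y₁} ℓ₁≢ℓ₂ leaf₁ leaf₂ nbhd₁ nbhd₂ maxS
    with SupportOf.maximum-meets-x leaf₁ nbhd₁ maxS
  ... | z , z∈S , z~x with z ≟ y₁
  ...   | no z≢y₁ = SupportOf.exchange leaf₁ nbhd₁ maxS z∈S z~x z≢y₁
  ...   | yes refl = SupportOf.exchange leaf₂ nbhd₂ maxS z∈S z~x
                       (supports-distinct ℓ₁≢ℓ₂ nbhd₁ nbhd₂)

mainTheorem13 : (n : ℕ) (G : Graph n) (ℓ₁ ℓ₂ y₁ y₂ x : Fin n) →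
    ℓ₁ ≢ ℓ₂ →
    IsLeafWithSupport G ℓ₁ y₁ → IsLeafWithSupport G ℓ₂ y₂ →
    NbhdIsPair G y₁ ℓ₁ x → NbhdIsPair G y₂ ℓ₂ x →
    ¬ HasUniqueMaxOpenPacking G
mainTheorem13 n G ℓ₁ ℓ₂ y₁ y₂ x ℓ₁≢ℓ₂ leaf₁ leaf₂ nbhd₁ nbhd₂ (S , maxS , unique)
  with rival-maximum G ℓ₁≢ℓ₂ leaf₁ leaf₂ nbhd₁ nbhd₂ maxS
... | T , maxT , T≢S = T≢S (unique T maxT)
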